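{- Let $A$ be a poset with a bottom element. Then the least upper bound, with respect to $\le$, of any set of passable games over $A$ is equivalent to a passable game.
   Context: Games over a poset $A$: $[a]$ atomic for $a\in A$; $\{L\mid R\}$ composite for non-empty sets $L,R$ of games (left and right options); atomic games have no options. $G\le H$ iff (1) every $G^L\triangleright H$, (2) every right option $H^R$ of $H$ has $G\triangleright H^R$, (3) if $G$ or $H$ atomic then $G\triangleright H$; $G\triangleright H$ iff (1) some $G^R\le H$, or (2) some left option $H^L$ of $H$ with $G\le H^L$, or (3) $G=[a],H=[b]$ atomic, $a\le b$. $G\equiv H$ iff $G\le H$ and $H\le G$. A least upper bound of a set $S$ of games is a game $M$ with $K\le M$ for all $K\in S$ and $M\le N$ for every $N$ with $K\le N$ for all $K\in S$ (when $A$ has a bottom element such a bound always exists and is unique up to $\equiv$). $G$ is passable if $G\triangleright G$ and all options of $G$ are passable (recursively). -}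

module Defs where

open import Level using (Level; _⊔_; suc; 0ℓ)
open import Data.Product using (Σ; _×_; _,_)
open import Data.Sum using (_⊎_)
open import Data.Empty using (⊥)
open import Data.Unit using (⊤)
open import Relation.Binary.Bundles using (Poset)

module _ {a ℓ₁ ℓ₂ : Level} (A : Poset a ℓ₁ ℓ₂) where
  open Poset A renaming (Carrier to ∣A∣; _≤_ to _≤A_)

  -- Games over the poset A.
  --   atom x          is the atomic game [x]
  --   comp I J i j L R is the composite game {L | R}, whose left options
  --                   are the family L indexed by I, right options the family
  --                   R indexed by J; i : I and j : J witness non-emptiness.
  data Game : Set (suc 0ℓ ⊔ a) where
    atom : ∣A∣ → Game
    comp : (I J : Set) → I → J → (I → Game) → (J → Game) → Game

  mutual
    _≤G_ : Game → Game → Set (ℓ₂)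
    atom x ≤G atom y = atom x ▷G atom y
    atom x ≤G (comp I J i j L R) =
      ((r : J) → atom x ▷G R r) × (atom x ▷G comp I J i j L R)
    (comp I J i j L R) ≤G atom y =
      ((l : I) → L l ▷G atom y) × (comp I J i j L R ▷G atom y)
    (comp I J i j L R) ≤G (comp I' J' i' j' L' R') =
      ((l : I) → L l ▷G comp I' J' i' j' L' R')
      × ((r : J') → comp I J i j L R ▷G R' r)

    _▷G_ : Game → Game → Set (ℓ₂)
    atom x ▷G atom y = x ≤A y
    atom x ▷G (comp I' J' i' j' L' R') = Σ I' λ l → atom x ≤G L' l
    (comp I J i j L R) ▷G atom y = Σ J λ r → R r ≤G atom y
    (comp I J i j L R) ▷G (comp I' J' i' j' L' R') =
      (Σ J λ r → R r ≤G comp I' J' i' j' L' R')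
      ⊎ (Σ I' λ l → comp I J i j L R ≤G L' l)

  _≡G_ : Game → Game → Set ℓ₂
  G ≡G H = (G ≤G H) × (H ≤G G)

  IsLUB : {K : Set} → (K → Game) → Game → Set (suc 0ℓ ⊔ a ⊔ ℓ₂)
  IsLUB {K} S M =
    ((k : K) → S k ≤G M)
    × ((N : Game) → ((k : K) → S k ≤G N) → M ≤G N)

  Passable : Game → Set ℓ₂
  Passable (atom x) = atom x ▷G atom x
  Passable (comp I J i j L R) =
    (comp I J i j L R ▷G comp I J i j L R)
    × ((l : I) → Passable (L l))
    × ((r : J) → Passable (R r))

  HasBottom : Set (a ⊔ ℓ₂)
  HasBottom = Σ ∣A∣ λ b → (x : ∣A∣) → b ≤A x

module Submission where

open import Defs
open import Data.Product using (Σ; _×_; _,_; proj₁; proj₂)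
open import Data.Sum using (_⊎_; inj₁; inj₂)
open import Data.Unit using (⊤; tt)
open import Function using (_∘_)
open import Relation.Binary.Bundles using (Poset)
open import Level using (Level)

-- With a bottom atom [⊥] at hand, the lub of the Sₖ can be written down
-- explicitly as P = {[⊥], Sₖᴸ | Y} (lub) with Y = {[⊥], Sₖ | [⊥]} (lub▷),
-- an atomic Sₖ counting as its own left option; [⊥] keeps the option sets
-- non-empty and lies below everything. Y is the least game X with every
-- Sₖ ▷ X, and P ≤ N unfolds exactly to "every Sₖ ≤ N". P is passable
-- because P ▷ P through Y ≤ P, which holds as Sₖ ▷ Sₖ ≤ P; every other
-- option is [⊥], some Sₖ or some Sₖᴸ. Since lubs are unique up to ≡, the
-- given lub is equivalent to P.

module _ {a ℓ₁ ℓ₂ : Level} (A : Poset a ℓ₁ ℓ₂) where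
  open Poset A using ()
    renaming (Carrier to ∣A∣; _≤_ to _≤A_; refl to ≤A-refl; trans to ≤A-trans)

  private
    _≤_ _▷_ : Game A → Game A → Set ℓ₂
    _≤_ = _≤G_ A
    _▷_ = _▷G_ A

  ▷-byLeftOption : ∀ G {I J i j L R} (l : I) → G ≤ L l → G ▷ comp I J i j L R
  ▷-byLeftOption (atom _)           l p = l , p
  ▷-byLeftOption (comp _ _ _ _ _ _) l p = inj₂ (l , p)

  ▷-byRightOption : ∀ {I J i j L R} H (r : J) → R r ≤ H → comp I J i j L R ▷ H
  ▷-byRightOption (atom _)           r p = r , p
  ▷-byRightOption (comp _ _ _ _ _ _) r p = inj₁ (r , p)

  -- An atomic game serves as its own unique left and right option; with this
  -- convention G ≤ H says exactly that every left option of G is ▷ H and G is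
  -- ▷ every right option of H (see ≤-intro, ≤-leftOf, ≤-rightOf).
  LeftIx RightIx : Game A → Set
  LeftIx (atom _)           = ⊤
  LeftIx (comp I _ _ _ _ _) = I
  RightIx (atom _)           = ⊤
  RightIx (comp _ J _ _ _ _) = J

  leftOf : (G : Game A) → LeftIx G → Game A
  leftOf G@(atom _)           _ = G
  leftOf   (comp _ _ _ _ L _) l = L l

  rightOf : (G : Game A) → RightIx G → Game A
  rightOf G@(atom _)           _ = G
  rightOf   (comp _ _ _ _ _ R) r = R r

  ≤-intro : ∀ G H → (∀ l → leftOf G l ▷ H) → (∀ r → G ▷ rightOf H r) → G ≤ H
  ≤-intro (atom _)           (atom _)           _ h = h tt
  ≤-intro (atom _)           (comp _ _ _ _ _ _) g h = h , g tt
  ≤-intro (comp _ _ _ _ _ _) (atom _)           g h = g , h tt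
  ≤-intro (comp _ _ _ _ _ _) (comp _ _ _ _ _ _) g h = g , h

  ≤-leftOf : ∀ G H → G ≤ H → ∀ l → leftOf G l ▷ H
  ≤-leftOf (atom _)           (atom _)           p _ = p
  ≤-leftOf (atom _)           (comp _ _ _ _ _ _) p _ = proj₂ p
  ≤-leftOf (comp _ _ _ _ _ _) (atom _)           p l = proj₁ p l
  ≤-leftOf (comp _ _ _ _ _ _) (comp _ _ _ _ _ _) p l = proj₁ p l

  ≤-rightOf : ∀ G H → G ≤ H → ∀ r → G ▷ rightOf H r
  ≤-rightOf (atom _)           (atom _)           p _ = p
  ≤-rightOf (atom _)           (comp _ _ _ _ _ _) p r = proj₁ p r
  ≤-rightOf (comp _ _ _ _ _ _) (atom _)           p _ = proj₂ p
  ≤-rightOf (comp _ _ _ _ _ _) (comp _ _ _ _ _ _) p r = proj₂ p r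

  ≤-refl : ∀ G → G ≤ G
  ≤-refl (atom _) = ≤A-refl
  ≤-refl (comp _ _ _ _ L R) =
    (λ l → ▷-byLeftOption (L l) l (≤-refl (L l))) ,
    (λ r → ▷-byRightOption (R r) r (≤-refl (R r)))

  mutual
    ▷-≤-trans : ∀ G H K → G ▷ H → H ≤ K → G ▷ K
    ▷-≤-trans (atom _) (atom _) (atom _) p q = ≤A-trans p q
    ▷-≤-trans G@(atom _) H@(atom _) (comp _ _ _ _ L _) p (_ , (l , q)) =
      l , ≤-trans G H (L l) p q
    ▷-≤-trans G@(atom _) H@(comp _ _ _ _ L _) K (l , p) q =
      ≤-▷-trans G (L l) K p (≤-leftOf H K q l)
    ▷-≤-trans (comp _ _ _ _ _ R) H@(atom _) K (r , p) q =
      ▷-byRightOption K r (≤-trans (R r) H K p q)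
    ▷-≤-trans (comp _ _ _ _ _ R) H@(comp _ _ _ _ _ _) K (inj₁ (r , p)) q =
      ▷-byRightOption K r (≤-trans (R r) H K p q)
    ▷-≤-trans G@(comp _ _ _ _ _ _) H@(comp _ _ _ _ L _) K (inj₂ (l , p)) q =
      ≤-▷-trans G (L l) K p (≤-leftOf H K q l)

    ≤-▷-trans : ∀ G H K → G ≤ H → H ▷ K → G ▷ K
    ≤-▷-trans (atom _) (atom _) (atom _) p q = ≤A-trans p q
    ≤-▷-trans G H@(atom _) (comp _ _ _ _ L _) p (l , q) =
      ▷-byLeftOption G l (≤-trans G H (L l) p q)
    ≤-▷-trans (comp _ _ _ _ _ R) H@(atom _) K@(atom _) (_ , (r , p)) q =
      r , ≤-trans (R r) H K p q
    ≤-▷-trans G H@(comp _ _ _ _ _ R) K@(atom _) p (r , q) =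
      ▷-≤-trans G (R r) K (≤-rightOf G H p r) q
    ≤-▷-trans G H@(comp _ _ _ _ _ R) K@(comp _ _ _ _ _ _) p (inj₁ (r , q)) =
      ▷-≤-trans G (R r) K (≤-rightOf G H p r) q
    ≤-▷-trans G H@(comp _ _ _ _ _ _) (comp _ _ _ _ L _) p (inj₂ (l , q)) =
      ▷-byLeftOption G l (≤-trans G H (L l) p q)

    ≤-trans : ∀ G H K → G ≤ H → H ≤ K → G ≤ K
    ≤-trans (atom _) (atom _) (atom _) p q = ≤A-trans p q
    ≤-trans G@(atom _) H@(atom _) K@(comp _ _ _ _ _ R) p (q₁ , q₂) =
      (λ r → ≤-▷-trans G H (R r) p (q₁ r)) , ≤-▷-trans G H K p q₂
    ≤-trans G@(atom _) (comp _ _ _ _ L _) K@(atom _) (_ , (l , p)) (q , _) =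
      ≤-▷-trans G (L l) K p (q l)
    ≤-trans G@(atom _) H@(comp _ _ _ _ L _) K@(comp _ _ _ _ _ R)
            p@(_ , (l , p′)) (q₁ , q₂) =
      (λ r → ≤-▷-trans G H (R r) p (q₂ r)) , ≤-▷-trans G (L l) K p′ (q₁ l)
    ≤-trans G@(comp _ _ _ _ L _) H K@(atom _) p q =
      (λ l → ▷-≤-trans (L l) H K (≤-leftOf G H p l) q) ,
      ≤-▷-trans G H K p (≤-rightOf H K q tt)
    ≤-trans G@(comp _ _ _ _ L _) H K@(comp _ _ _ _ _ R) p q =
      (λ l → ▷-≤-trans (L l) H K (≤-leftOf G H p l) q) ,
      (λ r → ≤-▷-trans G H (R r) p (≤-rightOf H K q r))

  IsLUB-unique : ∀ {K} {S : K → Game A} {M N} → IsLUB A S M → IsLUB A S N → _≡G_ A M N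
  IsLUB-unique (M-upper , M-least) (N-upper , N-least) =
    M-least _ N-upper , N-least _ M-upper

  passable⇒▷ : ∀ G → Passable A G → G ▷ G
  passable⇒▷ (atom _)           p = p
  passable⇒▷ (comp _ _ _ _ _ _) p = proj₁ p

  leftOf-passable : ∀ G → Passable A G → ∀ l → Passable A (leftOf G l)
  leftOf-passable (atom _)           p _ = p
  leftOf-passable (comp _ _ _ _ _ _) p l = proj₁ (proj₂ p) l

  atom-passable : ∀ x → Passable A (atom x)
  atom-passable _ = ≤A-refl

  module WithBottom (⊥A : ∣A∣) (⊥A-least : ∀ x → ⊥A ≤A x) where

    [⊥] : Game A
    [⊥] = atom ⊥A

    mutual
      [⊥]-least : ∀ G → [⊥] ≤ G
      [⊥]-least (atom x) = ⊥A-least x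
      [⊥]-least G@(comp _ _ _ _ _ R) = (λ r → [⊥]-▷ (R r)) , [⊥]-▷ G

      [⊥]-▷ : ∀ G → [⊥] ▷ G
      [⊥]-▷ (atom x) = ⊥A-least x
      [⊥]-▷ (comp _ _ l _ L _) = l , [⊥]-least (L l)

    module Join {K : Set} (S : K → Game A) where

      lub▷ : Game A
      lub▷ = comp (⊤ ⊎ K) ⊤ (inj₁ tt) tt left (λ _ → [⊥])
        where
        left : ⊤ ⊎ K → Game A
        left (inj₁ _) = [⊥]
        left (inj₂ k) = S k

      lub▷-upper : ∀ k → S k ▷ lub▷
      lub▷-upper k = ▷-byLeftOption (S k) (inj₂ k) (≤-refl (S k))

      lub▷-least : ∀ X → (∀ k → S k ▷ X) → lub▷ ≤ X
      lub▷-least X S▷X = ≤-intro lub▷ X left▷X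
        (λ r → ▷-byRightOption (rightOf X r) tt ([⊥]-least (rightOf X r)))
        where
        left▷X : ∀ l → leftOf lub▷ l ▷ X
        left▷X (inj₁ _) = [⊥]-▷ X
        left▷X (inj₂ k) = S▷X k

      lub : Game A
      lub = comp (⊤ ⊎ Σ K (LeftIx ∘ S)) ⊤ (inj₁ tt) tt left (λ _ → lub▷)
        where
        left : ⊤ ⊎ Σ K (LeftIx ∘ S) → Game A
        left (inj₁ _)       = [⊥]
        left (inj₂ (k , l)) = leftOf (S k) l

      lub-upper : ∀ k → S k ≤ lub
      lub-upper k = ≤-intro (S k) lub
        (λ l → ▷-byLeftOption (leftOf (S k) l) (inj₂ (k , l)) (≤-refl (leftOf (S k) l)))
        (λ _ → lub▷-upper k)

      lub-least : ∀ N → (∀ k → S k ≤ N) → lub ≤ N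
      lub-least N S≤N = ≤-intro lub N left▷N
        (λ r → ▷-byRightOption (rightOf N r) tt
                 (lub▷-least (rightOf N r) (λ k → ≤-rightOf (S k) N (S≤N k) r)))
        where
        left▷N : ∀ l → leftOf lub l ▷ N
        left▷N (inj₁ _)       = [⊥]-▷ N
        left▷N (inj₂ (k , l)) = ≤-leftOf (S k) N (S≤N k) l

      lub-isLUB : IsLUB A S lub
      lub-isLUB = lub-upper , lub-least

      module _ (S-passable : ∀ k → Passable A (S k)) where

        lub▷-passable : Passable A lub▷
        lub▷-passable =
          ▷-byRightOption lub▷ tt ([⊥]-least lub▷) , left-passable , (λ _ → atom-passable ⊥A)
          where
          left-passable : ∀ l → Passable A (leftOf lub▷ l)
          left-passable (inj₁ _) = atom-passable ⊥A
          left-passable (inj₂ k) = S-passable k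

        lub-passable : Passable A lub
        lub-passable = lub▷lub , left-passable , (λ _ → lub▷-passable)
          where
          lub▷lub : lub ▷ lub
          lub▷lub = ▷-byRightOption lub tt (lub▷-least lub (λ k →
            ▷-≤-trans (S k) (S k) lub (passable⇒▷ (S k) (S-passable k)) (lub-upper k)))

          left-passable : ∀ l → Passable A (leftOf lub l)
          left-passable (inj₁ _)       = atom-passable ⊥A
          left-passable (inj₂ (k , l)) = leftOf-passable (S k) (S-passable k) l

lemma6p4 : {a ℓ₁ ℓ₂ : Level} (A : Poset a ℓ₁ ℓ₂) → HasBottom A →
    (K : Set) (S : K → Game A) → ((k : K) → Passable A (S k)) →
    (M : Game A) → IsLUB A S M →
    Σ (Game A) (λ P → Passable A P × _≡G_ A M P)
lemma6p4 A (⊥A , ⊥A-least) K S S-passable M M-isLUB =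
  lub , lub-passable S-passable , IsLUB-unique A {S = S} M-isLUB lub-isLUB
  where open WithBottom A ⊥A ⊥A-least
        open Join S
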